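{- For every graph $G$, $\max\rho(G)\le 4\,\mathbb{E}\rho(G)$.
   Context: Graphs are finite and simple. $\rho_G(X)$ is the binary rank of the $X\times(V(G)\setminus X)$ adjacency submatrix; $\max\rho(G)=\max_{S\subseteq V(G)}\rho_G(S)$ and $\mathbb{E}\rho(G)=2^{ -|V(G)|}\sum_{S\subseteq V(G)}\rho_G(S)$. -}

module Defs where

open import Data.Bool using (Bool; true; false; if_then_else_; not; _xor_)
open import Data.Nat using (ℕ; zero; suc; _+_; _*_; _⊔_)
open import Data.Fin using (Fin)
open import Data.Fin.Subset using (Subset)
open import Data.List using (List; []; _∷_; map; filter; zipWith; allFin; foldr)
open import Data.Nat.ListAction using (sum)
open import Data.Vec using (Vec; lookup)
import Data.Vec as Vec
open import Data.Maybe using (Maybe; just; nothing)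
open import Data.Product using (_×_; _,_)
open import Relation.Binary.PropositionalEquality using (_≡_)
open import Relation.Nullary using (¬_)
open import Data.Bool.Properties using (T?)

record Graph (n : ℕ) : Set where
  field
    adj   : Fin n → Fin n → Bool
    sym   : ∀ x y → adj x y ≡ adj y x
    irrefl : ∀ x → adj x x ≡ false
open Graph public

-- Rank over GF(2) (= Bool with xor) of a 0/1 matrix given as a list of
-- rows, by Gaussian elimination, column by column.

head0 : List Bool → Bool
head0 []      = false
head0 (b ∷ _) = b

tail0 : List Bool → List Bool
tail0 []       = []
tail0 (_ ∷ bs) = bs

addRow : List Bool → List Bool → List Bool
addRow = zipWith _xor_

pivotSplit : List (List Bool) → Maybe (List Bool × List (List Bool))
pivotSplit [] = nothing
pivotSplit (r ∷ rs) with head0 r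
... | true  = just (r , rs)
... | false with pivotSplit rs
...   | nothing        = nothing
...   | just (p , rs') = just (p , r ∷ rs')

-- rankAux c M : GF(2)-rank of M, assuming M has at most c columns
rankAux : ℕ → List (List Bool) → ℕ
rankAux zero    rows = 0
rankAux (suc c) rows with pivotSplit rows
... | nothing        = rankAux c (map tail0 rows)
... | just (p , rest) =
  suc (rankAux c (map (λ r → tail0 (if head0 r then addRow r p else r)) rest))

inS : ∀ {n} → Subset n → Fin n → Bool
inS S x = lookup S x

cutMatrix : ∀ {n} → Graph n → Subset n → List (List Bool)
cutMatrix {n} G X =
  map (λ x → map (adj G x) (filter (λ y → T? (not (inS X y))) (allFin n)))
      (filter (λ x → T? (inS X x)) (allFin n))

ρ : ∀ {n} → Graph n → Subset n → ℕ
ρ {n} G X = rankAux n (cutMatrix G X)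

allSubsets : (n : ℕ) → List (Subset n)
allSubsets zero    = Vec.[] ∷ []
allSubsets (suc n) =
  map (Vec._∷_ true) (allSubsets n) Data.List.++ map (Vec._∷_ false) (allSubsets n)

maxρ : ∀ {n} → Graph n → ℕ
maxρ {n} G = foldr _⊔_ 0 (map (ρ G) (allSubsets n))

-- Σ_{S ⊆ V(G)} ρ_G(S)  (so that 𝔼ρ(G) = sumρ G / 2^n)
sumρ : ∀ {n} → Graph n → ℕ
sumρ {n} G = sum (map (ρ G) (allSubsets n))

{-# OPTIONS --safe #-}
-- Fix X. For every S, each row x ∈ X of the X-cut is the sum of two rows x of cuts of translates
-- of S, restricted to the columns V ∖ X: of the S- and (S Δ ∁X)-cuts if x ∈ S, of the (S Δ V)-
-- and (S Δ X)-cuts otherwise; in both pairs the two sets differ exactly on ∁X. Hence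
-- ρ(X) ≤ ρ(S) + ρ(S Δ ∁X) + ρ(S Δ V) + ρ(S Δ X), and summing over all S, using that S ↦ S Δ C
-- permutes the subsets, gives 2ⁿ ρ(X) ≤ 4 Σ_S ρ(S). Rank enters only through spans: the
-- elimination procedure defining ρ computes the least size of a GF(2)-spanning set of the rows,
-- by the exchange lemma.
module Submission where

open import Defs hiding (sym)
open import Algebra.Bundles using (CommutativeRing)
import Algebra.Properties.CommutativeSemigroup as CommutativeSemigroupProperties
open import Data.Bool using (Bool; true; false; not; _∧_; _xor_; T; if_then_else_)
open import Data.Bool.Properties
  using (xor-∧-commutativeRing; xor-assoc; xor-comm; xor-same; xor-identityʳ;
         ∧-zeroʳ; ∧-distribˡ-xor; ∧-distribʳ-xor; T-≡)
open import Data.Fin using (Fin)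
import Data.Fin as Fin
open import Data.Fin.Subset using (Subset; ⊤; ∁)
open import Data.List using (List; []; _∷_; _++_; map; filter; length; foldr; allFin)
open import Data.List.Properties using (length-map; length-++; map-++; map-∘; length-filter; length-tabulate)
open import Data.List.Membership.Propositional using (_∈_)
open import Data.List.Membership.Propositional.Properties using (∈-allFin; ∈-filter⁺)
open import Data.List.Relation.Unary.All as All using (All; []; _∷_)
open import Data.List.Relation.Unary.All.Properties using (all-filter; map⁺; map⁻)
open import Data.List.Relation.Unary.Any using (here; there)
open import Data.List.Relation.Binary.Permutation.Propositional using (_↭_; ↭-refl; ↭-prep; ↭-swap; ↭-trans; ↭-sym)
open import Data.List.Relation.Binary.Permutation.Propositional.Properties using (All-resp-↭)
open import Data.Maybe using (Maybe; just; nothing; maybe)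
open import Data.Nat using (ℕ; zero; suc; _+_; _*_; _^_; _∸_; _⊔_; _≤_; z≤n; s≤s)
open import Data.Nat.ListAction using (sum)
open import Data.Nat.ListAction.Properties using (sum-++)
open import Data.Nat.Properties
  using (+-commutativeSemigroup; +-comm; +-assoc; +-identityʳ; +-mono-≤; *-zeroʳ; *-distribˡ-⊔; ⊔-lub;
         suc-injective; n≤0⇒n≡0; ∸-monoˡ-≤; ≤-trans; ≤-reflexive; module ≤-Reasoning)
open import Data.Product using (∃-syntax; _×_; _,_)
import Data.Vec as Vec
open import Data.Vec.Properties using (lookup-zipWith; lookup-map; lookup-replicate)
open import Function using (_∘_; const)
open import Function.Bundles using (Equivalence)
open import Relation.Binary.Definitions using (DecidableEquality)
open import Relation.Binary.PropositionalEquality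
  using (_≡_; _≗_; refl; sym; trans; cong; cong₂; module ≡-Reasoning)
open import Relation.Nullary using (yes; no; does; contradiction)
open import Relation.Nullary.Decidable using (T?)

open CommutativeSemigroupProperties (CommutativeRing.+-commutativeSemigroup xor-∧-commutativeRing)
  using () renaming (interchange to xor-interchange; x∙yz≈y∙xz to xor-leftComm)
open CommutativeSemigroupProperties +-commutativeSemigroup
  using () renaming (interchange to +-interchange)

xor-cancelˡ : ∀ a b → a xor (a xor b) ≡ b
xor-cancelˡ a b = trans (sym (xor-assoc a a b)) (cong (_xor b) (xor-same a))

xor-cancelʳ : ∀ a b → (a xor b) xor b ≡ a
xor-cancelʳ a b = trans (xor-assoc a b b) (trans (cong (a xor_) (xor-same b)) (xor-identityʳ a))

xor-cancel-common : ∀ c a b → (c xor a) xor (c xor b) ≡ a xor b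
xor-cancel-common c a b = trans (xor-interchange c a c b) (cong (_xor (a xor b)) (xor-same c))

-- Spans over GF(2)

module _ {I : Set} where

  infixl 6 _⊕_
  _⊕_ : (I → Bool) → (I → Bool) → I → Bool
  (f ⊕ g) i = f i xor g i

  mask : (I → Bool) → (I → Bool) → I → Bool
  mask m f i = m i ∧ f i

  clear : I → (I → Bool) → (I → Bool) → I → Bool
  clear i₀ p f i = f i xor (f i₀ ∧ p i)

  -- f ∈⟨ vs ⟩: f is a GF(2)-combination of vs, the constructors choosing the coefficients
  -- in turn; equations are pointwise since there is no function extensionality.
  infix 4 _∈⟨_⟩
  data _∈⟨_⟩ : (I → Bool) → List (I → Bool) → Set where
    none : ∀ {f} → f ≗ const false → f ∈⟨ [] ⟩
    skip : ∀ {f v vs} → f ∈⟨ vs ⟩ → f ∈⟨ v ∷ vs ⟩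
    use  : ∀ {f g v vs} → g ∈⟨ vs ⟩ → f ≗ v ⊕ g → f ∈⟨ v ∷ vs ⟩

  ∈⟨⟩-resp-≗ : ∀ {f h vs} → f ≗ h → f ∈⟨ vs ⟩ → h ∈⟨ vs ⟩
  ∈⟨⟩-resp-≗ f≗h (none f≗0)   = none (λ i → trans (sym (f≗h i)) (f≗0 i))
  ∈⟨⟩-resp-≗ f≗h (skip f∈)    = skip (∈⟨⟩-resp-≗ f≗h f∈)
  ∈⟨⟩-resp-≗ f≗h (use g∈ f≗)  = use g∈ (λ i → trans (sym (f≗h i)) (f≗ i))

  const-false-∈⟨⟩ : ∀ vs → const false ∈⟨ vs ⟩
  const-false-∈⟨⟩ []       = none (λ _ → refl)
  const-false-∈⟨⟩ (_ ∷ vs) = skip (const-false-∈⟨⟩ vs)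

  ∈⟨⟩-⊕ : ∀ {f g vs} → f ∈⟨ vs ⟩ → g ∈⟨ vs ⟩ → f ⊕ g ∈⟨ vs ⟩
  ∈⟨⟩-⊕ (none f≗0) (none g≗0) = none (λ i → cong₂ _xor_ (f≗0 i) (g≗0 i))
  ∈⟨⟩-⊕ (skip f∈) (skip g∈) = skip (∈⟨⟩-⊕ f∈ g∈)
  ∈⟨⟩-⊕ {f} (skip f∈) (use {g = g′} {v} g′∈ g≗) =
    use (∈⟨⟩-⊕ f∈ g′∈) (λ i → trans (cong (f i xor_) (g≗ i)) (xor-leftComm (f i) (v i) (g′ i)))
  ∈⟨⟩-⊕ {g = g} (use {g = f′} {v} f′∈ f≗) (skip g∈) =
    use (∈⟨⟩-⊕ f′∈ g∈) (λ i → trans (cong (_xor g i) (f≗ i)) (xor-assoc (v i) (f′ i) (g i)))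
  ∈⟨⟩-⊕ (use {g = f′} {v} f′∈ f≗) (use {g = g′} g′∈ g≗) =
    skip (∈⟨⟩-resp-≗ (λ i → sym (trans (cong₂ _xor_ (f≗ i) (g≗ i)) (xor-cancel-common (v i) (f′ i) (g′ i))))
                     (∈⟨⟩-⊕ f′∈ g′∈))

  ∈⟨⟩-++⁺ˡ : ∀ {f vs} ws → f ∈⟨ vs ⟩ → f ∈⟨ vs ++ ws ⟩
  ∈⟨⟩-++⁺ˡ ws (none f≗0)  = ∈⟨⟩-resp-≗ (λ i → sym (f≗0 i)) (const-false-∈⟨⟩ ws)
  ∈⟨⟩-++⁺ˡ ws (skip f∈)   = skip (∈⟨⟩-++⁺ˡ ws f∈)
  ∈⟨⟩-++⁺ˡ ws (use g∈ f≗) = use (∈⟨⟩-++⁺ˡ ws g∈) f≗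

  ∈⟨⟩-++⁺ʳ : ∀ {f ws} vs → f ∈⟨ ws ⟩ → f ∈⟨ vs ++ ws ⟩
  ∈⟨⟩-++⁺ʳ []       f∈ = f∈
  ∈⟨⟩-++⁺ʳ (_ ∷ vs) f∈ = skip (∈⟨⟩-++⁺ʳ vs f∈)

-- Respecting ≗ is a genuine condition here, for want of function extensionality.
record IsLinear {I J : Set} (L : (I → Bool) → J → Bool) : Set where
  field
    resp-≗  : ∀ {f g} → f ≗ g → L f ≗ L g
    ⊕-homo  : ∀ f g → L (f ⊕ g) ≗ L f ⊕ L g
    0-homo  : L (const false) ≗ const false

  ≗-⊕ : ∀ {f} g h → f ≗ g ⊕ h → L f ≗ L g ⊕ L h
  ≗-⊕ g h f≗ i = trans (resp-≗ f≗ i) (⊕-homo g h i)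

  ≗-0 : ∀ {f} → f ≗ const false → L f ≗ const false
  ≗-0 f≗0 i = trans (resp-≗ f≗0 i) (0-homo i)

∈⟨⟩-map : ∀ {I J} {L : (I → Bool) → J → Bool} → IsLinear L → ∀ {f vs} → f ∈⟨ vs ⟩ → L f ∈⟨ map L vs ⟩
∈⟨⟩-map lin (none f≗0)  = none (IsLinear.≗-0 lin f≗0)
∈⟨⟩-map lin (skip f∈)   = skip (∈⟨⟩-map lin f∈)
∈⟨⟩-map lin (use {g = g} {v} g∈ f≗) = use (∈⟨⟩-map lin g∈) (IsLinear.≗-⊕ lin v g f≗)

pull : ∀ {I J : Set} → (J → Maybe I) → (I → Bool) → J → Bool
pull φ f j = maybe f false (φ j)

pull-isLinear : ∀ {I J : Set} (φ : J → Maybe I) → IsLinear (pull φ)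
pull-isLinear φ = record { resp-≗ = resp-≗ ; ⊕-homo = ⊕-homo ; 0-homo = 0-homo }
  where
  resp-≗ : ∀ {f g} → f ≗ g → pull φ f ≗ pull φ g
  resp-≗ f≗g j with φ j
  ... | nothing = refl
  ... | just i  = f≗g i

  ⊕-homo : ∀ f g → pull φ (f ⊕ g) ≗ pull φ f ⊕ pull φ g
  ⊕-homo f g j with φ j
  ... | nothing = refl
  ... | just i  = refl

  0-homo : pull φ (const false) ≗ const false
  0-homo j with φ j
  ... | nothing = refl
  ... | just i  = refl

mask-isLinear : ∀ {I} (m : I → Bool) → IsLinear (mask m)
mask-isLinear m = record
  { resp-≗ = λ f≗g i → cong (m i ∧_) (f≗g i)
  ; ⊕-homo = λ f g i → ∧-distribˡ-xor (m i) (f i) (g i)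
  ; 0-homo = λ i → ∧-zeroʳ (m i)
  }

module _ {I : Set} (i₀ : I) (p : I → Bool) where

  clear-isLinear : IsLinear (clear i₀ p)
  clear-isLinear = record
    { resp-≗ = λ f≗g i → cong₂ (λ a b → a xor (b ∧ p i)) (f≗g i) (f≗g i₀)
    ; ⊕-homo = ⊕-homo
    ; 0-homo = λ _ → refl
    }
    where
    ⊕-homo : ∀ f g → clear i₀ p (f ⊕ g) ≗ clear i₀ p f ⊕ clear i₀ p g
    ⊕-homo f g i = begin
      (f i xor g i) xor ((f i₀ xor g i₀) ∧ p i)          ≡⟨ cong ((f i xor g i) xor_) (∧-distribʳ-xor (p i) (f i₀) (g i₀)) ⟩
      (f i xor g i) xor ((f i₀ ∧ p i) xor (g i₀ ∧ p i))  ≡⟨ xor-interchange (f i) (g i) _ _ ⟩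
      (f i xor (f i₀ ∧ p i)) xor (g i xor (g i₀ ∧ p i))  ∎
      where open ≡-Reasoning

  clear-self : p i₀ ≡ true → clear i₀ p p ≗ const false
  clear-self p₀ i = trans (cong (λ b → p i xor (b ∧ p i)) p₀) (xor-same (p i))

  -- Steinitz exchange: clear i₀ p is linear and kills p, so one vector of vs becomes redundant.
  exchange : ∀ {vs} → p ∈⟨ vs ⟩ → p i₀ ≡ true →
             ∃[ ws ] suc (length ws) ≡ length vs × (∀ {f} → f ∈⟨ vs ⟩ → clear i₀ p f ∈⟨ ws ⟩)
  exchange (none p≗0) p₀ with () ← trans (sym p₀) (p≗0 i₀)
  exchange (skip {v = v} p∈) p₀ with ws , len , clear∈ ← exchange p∈ p₀ =
    clear i₀ p v ∷ ws , cong suc len , λ where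
      (skip f∈)           → skip (clear∈ f∈)
      (use {g = g} g∈ f≗) → use (clear∈ g∈) (IsLinear.≗-⊕ clear-isLinear v g f≗)
  exchange (use {g = g} {v} {vs} g∈ p≗) p₀ =
    map (clear i₀ p) vs , cong suc (length-map _ vs) , λ where
      (skip f∈)   → ∈⟨⟩-map clear-isLinear f∈
      (use h∈ f≗) → ∈⟨⟩-resp-≗ (λ i → sym (clear-use f≗ i))
                               (∈⟨⟩-⊕ (∈⟨⟩-map clear-isLinear g∈) (∈⟨⟩-map clear-isLinear h∈))
    where
    open IsLinear clear-isLinear

    v≗p⊕g : v ≗ p ⊕ g
    v≗p⊕g i = trans (sym (xor-cancelʳ (v i) (g i))) (cong (_xor g i) (sym (p≗ i)))

    clear-v : clear i₀ p v ≗ clear i₀ p g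
    clear-v i = trans (≗-⊕ p g v≗p⊕g i) (cong (_xor clear i₀ p g i) (clear-self p₀ i))

    clear-use : ∀ {f h} → f ≗ v ⊕ h → clear i₀ p f ≗ clear i₀ p g ⊕ clear i₀ p h
    clear-use {h = h} f≗ i = trans (≗-⊕ v h f≗ i) (cong (_xor clear i₀ p h i) (clear-v i))

-- Gaussian elimination computes the rank

entry : List Bool → ℕ → Bool
entry []       _       = false
entry (b ∷ _)  zero    = b
entry (_ ∷ bs) (suc i) = entry bs i

shift : (ℕ → Bool) → ℕ → Bool
shift = pull (just ∘ suc)

predecessor : ℕ → Maybe ℕ
predecessor zero    = nothing
predecessor (suc i) = just i

unshift : (ℕ → Bool) → ℕ → Bool
unshift = pull predecessor

shift-isLinear : IsLinear shift
shift-isLinear = pull-isLinear (just ∘ suc)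

unshift-isLinear : IsLinear unshift
unshift-isLinear = pull-isLinear predecessor

HasWidth : ℕ → List (List Bool) → Set
HasWidth L = All (λ r → length r ≡ L)

eliminate : List Bool → List Bool → List Bool
eliminate p r = tail0 (if head0 r then addRow r p else r)

head0≡entry0 : ∀ r → head0 r ≡ entry r 0
head0≡entry0 []      = refl
head0≡entry0 (_ ∷ _) = refl

entry-empty : ∀ r → length r ≡ 0 → entry r ≗ const false
entry-empty [] _ _ = refl

entry-tail0 : ∀ r → shift (entry r) ≗ entry (tail0 r)
entry-tail0 []      _ = refl
entry-tail0 (_ ∷ _) _ = refl

unshift-entry-tail0 : ∀ r → head0 r ≡ false → unshift (entry (tail0 r)) ≗ entry r
unshift-entry-tail0 []          _ zero    = refl
unshift-entry-tail0 []          _ (suc _) = refl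
unshift-entry-tail0 (false ∷ _) _ zero    = refl
unshift-entry-tail0 (false ∷ _) _ (suc _) = refl

length-tail0 : ∀ r → length (tail0 r) ≡ length r ∸ 1
length-tail0 []      = refl
length-tail0 (_ ∷ _) = refl

entry-addRow : ∀ r p → length r ≡ length p → entry (addRow r p) ≗ entry r ⊕ entry p
entry-addRow []      []      _ _       = refl
entry-addRow (_ ∷ _) (_ ∷ _) _ zero    = refl
entry-addRow (_ ∷ r) (_ ∷ p) e (suc i) = entry-addRow r p (suc-injective e) i

length-addRow : ∀ r p → length r ≡ length p → length (addRow r p) ≡ length r
length-addRow []      []      _ = refl
length-addRow (_ ∷ r) (_ ∷ p) e = cong suc (length-addRow r p (suc-injective e))

entry-eliminate : ∀ p r → length r ≡ length p → entry (eliminate p r) ≗ shift (clear 0 (entry p) (entry r))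
entry-eliminate _       []          _ _ = refl
entry-eliminate (_ ∷ p) (true ∷ r)  e   = entry-addRow r p (suc-injective e)
entry-eliminate _       (false ∷ r) _ i = sym (xor-identityʳ (entry r i))

length-eliminate : ∀ p r → length r ≡ length p → length (eliminate p r) ≡ length r ∸ 1
length-eliminate _       []          _ = refl
length-eliminate (_ ∷ p) (true ∷ r)  e = length-addRow r p (suc-injective e)
length-eliminate _       (false ∷ r) _ = refl

uneliminate-∈⟨⟩ : ∀ {ws} p r → head0 p ≡ true → length r ≡ length p →
                  entry (eliminate p r) ∈⟨ ws ⟩ → entry r ∈⟨ entry p ∷ map unshift ws ⟩
uneliminate-∈⟨⟩ (true ∷ p) (false ∷ r) _ _ r′∈ =
  skip (∈⟨⟩-resp-≗ (unshift-entry-tail0 (false ∷ r) refl) (∈⟨⟩-map unshift-isLinear r′∈))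
uneliminate-∈⟨⟩ (true ∷ p) (true ∷ r) _ e r′∈ = use (∈⟨⟩-map unshift-isLinear r′∈) pointwise
  where
  pointwise : entry (true ∷ r) ≗ entry (true ∷ p) ⊕ unshift (entry (addRow r p))
  pointwise zero    = refl
  pointwise (suc i) = begin
    entry r i                               ≡⟨ xor-cancelʳ (entry r i) (entry p i) ⟨
    (entry r i xor entry p i) xor entry p i ≡⟨ xor-comm _ (entry p i) ⟩
    entry p i xor (entry r i xor entry p i) ≡⟨ cong (entry p i xor_) (entry-addRow r p (suc-injective e) i) ⟨
    entry p i xor entry (addRow r p) i      ∎
    where open ≡-Reasoning

pivotSplit-nothing : ∀ M → pivotSplit M ≡ nothing → All (λ r → head0 r ≡ false) M
pivotSplit-nothing []       _  = []
pivotSplit-nothing (r ∷ rs) eq with head0 r in h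
pivotSplit-nothing (r ∷ rs) () | true
... | false with pivotSplit rs in eq′
...   | nothing = h ∷ pivotSplit-nothing rs eq′
pivotSplit-nothing (r ∷ rs) () | false | just _

pivotSplit-just : ∀ M {p rest} → pivotSplit M ≡ just (p , rest) → head0 p ≡ true × M ↭ p ∷ rest
pivotSplit-just []       ()
pivotSplit-just (r ∷ rs) eq with head0 r in h
pivotSplit-just (r ∷ rs) refl | true = h , ↭-refl
... | false with pivotSplit rs in eq′
pivotSplit-just (r ∷ rs) ()   | false | nothing
pivotSplit-just (r ∷ rs) refl | false | just (p , _) with p₀ , rs↭ ← pivotSplit-just rs eq′ =
  p₀ , ↭-trans (↭-prep r rs↭) (↭-swap r p ↭-refl)

tails-width : ∀ {L M} → HasWidth L M → HasWidth (L ∸ 1) (map tail0 M)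
tails-width = map⁺ ∘ All.map (λ {r} lr → trans (length-tail0 r) (cong (_∸ 1) lr))

eliminated-width : ∀ {L p rest} → length p ≡ L → HasWidth L rest → HasWidth (L ∸ 1) (map (eliminate p) rest)
eliminated-width {p = p} lp =
  map⁺ ∘ All.map (λ {r} lr → trans (length-eliminate p r (trans lr (sym lp))) (cong (_∸ 1) lr))

tails-∈⟨⟩ : ∀ {vs M} → All (λ r → entry r ∈⟨ vs ⟩) M → All (λ r → entry r ∈⟨ map shift vs ⟩) (map tail0 M)
tails-∈⟨⟩ = map⁺ ∘ All.map (λ {r} r∈ → ∈⟨⟩-resp-≗ (entry-tail0 r) (∈⟨⟩-map shift-isLinear r∈))

rankAux-≤-spanning : ∀ c {L M vs} → HasWidth L M → All (λ r → entry r ∈⟨ vs ⟩) M → rankAux c M ≤ length vs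
rankAux-≤-spanning zero    _ _ = z≤n
rankAux-≤-spanning (suc c) {L} {M} {vs} width spanned with pivotSplit M in eq
... | nothing = begin
  rankAux c (map tail0 M) ≤⟨ rankAux-≤-spanning c (tails-width width) (tails-∈⟨⟩ spanned) ⟩
  length (map shift vs)   ≡⟨ length-map shift vs ⟩
  length vs               ∎
  where open ≤-Reasoning
... | just (p , rest)
  with p₀ , M↭ ← pivotSplit-just M eq
  with lp ∷ lrest ← All-resp-↭ M↭ width | p∈ ∷ rest∈ ← All-resp-↭ M↭ spanned
  with ws , len , clear∈ ← exchange 0 (entry p) p∈ (trans (sym (head0≡entry0 p)) p₀) = begin
  suc (rankAux c (map (eliminate p) rest))
    ≤⟨ s≤s (rankAux-≤-spanning c (eliminated-width lp lrest) eliminated∈) ⟩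
  suc (length (map shift ws)) ≡⟨ cong suc (length-map shift ws) ⟩
  suc (length ws)             ≡⟨ len ⟩
  length vs                   ∎
  where
  open ≤-Reasoning
  eliminate-∈⟨⟩ : ∀ {r} → length r ≡ L × entry r ∈⟨ vs ⟩ → entry (eliminate p r) ∈⟨ map shift ws ⟩
  eliminate-∈⟨⟩ {r} (lr , r∈) = ∈⟨⟩-resp-≗ (λ i → sym (entry-eliminate p r (trans lr (sym lp)) i))
                                           (∈⟨⟩-map shift-isLinear (clear∈ r∈))

  eliminated∈ : All (λ r → entry r ∈⟨ map shift ws ⟩) (map (eliminate p) rest)
  eliminated∈ = map⁺ (All.zipWith (λ {r} → eliminate-∈⟨⟩ {r}) (lrest , rest∈))

spanning-≤-rankAux : ∀ c {L M} → L ≤ c → HasWidth L M →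
                     ∃[ ws ] length ws ≤ rankAux c M × All (λ r → entry r ∈⟨ ws ⟩) M
spanning-≤-rankAux zero L≤0 width =
  [] , z≤n , All.map (λ {r} lr → none (entry-empty r (trans lr (n≤0⇒n≡0 L≤0)))) width
spanning-≤-rankAux (suc c) {L} {M} L≤ width with pivotSplit M in eq
spanning-≤-rankAux (suc c) {L} {M} L≤ width | nothing
  with ws , len , spanned ← spanning-≤-rankAux c (∸-monoˡ-≤ 1 L≤) (tails-width width) =
  map unshift ws , ≤-trans (≤-reflexive (length-map unshift ws)) len ,
  All.zipWith (λ {r} → untail∈ {r}) (pivotSplit-nothing M eq , map⁻ spanned)
  where
  untail∈ : ∀ {r} → head0 r ≡ false × entry (tail0 r) ∈⟨ ws ⟩ → entry r ∈⟨ map unshift ws ⟩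
  untail∈ {r} (h , r′∈) = ∈⟨⟩-resp-≗ (unshift-entry-tail0 r h) (∈⟨⟩-map unshift-isLinear r′∈)
spanning-≤-rankAux (suc c) {L} {M} L≤ width | just (p , rest)
  with p₀ , M↭ ← pivotSplit-just M eq
  with lp ∷ lrest ← All-resp-↭ M↭ width
  with ws , len , spanned ← spanning-≤-rankAux c (∸-monoˡ-≤ 1 L≤) (eliminated-width lp lrest) =
  entry p ∷ map unshift ws , s≤s (≤-trans (≤-reflexive (length-map unshift ws)) len) ,
  All-resp-↭ (↭-sym M↭) (p∈ ∷ All.zipWith (λ {r} → rest∈ {r}) (lrest , map⁻ spanned))
  where
  p∈ : entry p ∈⟨ entry p ∷ map unshift ws ⟩
  p∈ = use (const-false-∈⟨⟩ _) (λ i → sym (xor-identityʳ (entry p i)))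
  rest∈ : ∀ {r} → length r ≡ L × entry (eliminate p r) ∈⟨ ws ⟩ → entry r ∈⟨ entry p ∷ map unshift ws ⟩
  rest∈ {r} (lr , r′∈) = uneliminate-∈⟨⟩ p r p₀ (trans lr (sym lp)) r′∈

-- Cut-rank through spanning sets

lookupMaybe : ∀ {A : Set} → List A → ℕ → Maybe A
lookupMaybe []       _       = nothing
lookupMaybe (y ∷ _)  zero    = just y
lookupMaybe (_ ∷ ys) (suc j) = lookupMaybe ys j

entry-map-local : ∀ {A : Set} {h h′ : A → Bool} {ys} → All (λ y → h y ≡ h′ y) ys →
                  entry (map h ys) ≗ pull (lookupMaybe ys) h′
entry-map-local []       _       = refl
entry-map-local (e ∷ _)  zero    = e
entry-map-local (_ ∷ es) (suc j) = entry-map-local es j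

module _ {A : Set} (_≟_ : DecidableEquality A) where

  position : List A → A → ℕ
  position []       _ = 0
  position (z ∷ zs) y = if does (z ≟ y) then 0 else suc (position zs y)

  entry-map-position : ∀ (h : A → Bool) {ys y} → y ∈ ys → entry (map h ys) (position ys y) ≡ h y
  entry-map-position h {z ∷ _} {y} y∈ with z ≟ y | y∈
  ... | yes refl | _          = refl
  ... | no z≢y   | here refl  = contradiction refl z≢y
  ... | no _     | there y∈zs = entry-map-position h y∈zs

_Δ_ : ∀ {n} → Subset n → Subset n → Subset n
S Δ C = Vec.zipWith _xor_ S C

inS-Δ : ∀ {n} (S C : Subset n) {y b} → inS C y ≡ b → inS (S Δ C) y ≡ inS S y xor b
inS-Δ S C {y} e = trans (lookup-zipWith _xor_ y S C) (cong (inS S y xor_) e)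

inS-∁ : ∀ {n} (X : Subset n) {y b} → inS X y ≡ b → inS (∁ X) y ≡ not b
inS-∁ X {y} e = trans (lookup-map y not X) (cong not e)

inS-⊤ : ∀ {n} (y : Fin n) → inS ⊤ y ≡ true
inS-⊤ y = lookup-replicate y true

module _ {n : ℕ} (G : Graph n) where

  outside : Subset n → Fin n → Bool
  outside X y = not (inS X y)

  columns : Subset n → List (Fin n)
  columns X = filter (λ y → T? (not (inS X y))) (allFin n)

  -- Row x of the X × (V ∖ X) adjacency matrix, indexed by all of V and zero on X.
  cutRow : Subset n → Fin n → Fin n → Bool
  cutRow X x = mask (outside X) (adj G x)

  cutRow-outside : ∀ X x {y} → T (outside X y) → cutRow X x y ≡ adj G x y
  cutRow-outside X x {y} _ with inS X y
  ... | false = refl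

  CutSpannedBy : Subset n → List (Fin n → Bool) → Set
  CutSpannedBy X vs = ∀ x → inS X x ≡ true → cutRow X x ∈⟨ vs ⟩

  columns-length : ∀ X → length (columns X) ≤ n
  columns-length X = ≤-trans (length-filter _ (allFin n)) (≤-reflexive (length-tabulate _))

  cutMatrix-width : ∀ X → HasWidth (length (columns X)) (cutMatrix G X)
  cutMatrix-width X = map⁺ (All.map (λ {x} _ → length-map (adj G x) (columns X)) (all-filter _ (allFin n)))

  ρ-≤-spanning-set : ∀ X {vs} → CutSpannedBy X vs → ρ G X ≤ length vs
  ρ-≤-spanning-set X {vs} spans = begin
    ρ G X                                             ≤⟨ rankAux-≤-spanning n (cutMatrix-width X) rows∈ ⟩
    length (map (pull (lookupMaybe (columns X))) vs)  ≡⟨ length-map _ vs ⟩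
    length vs                                         ∎
    where
    open ≤-Reasoning
    row∈ : ∀ {x} → T (inS X x) → entry (map (adj G x) (columns X)) ∈⟨ map (pull (lookupMaybe (columns X))) vs ⟩
    row∈ {x} x∈X =
      ∈⟨⟩-resp-≗ (λ j → sym (entry-map-local row≡ j))
                 (∈⟨⟩-map (pull-isLinear (lookupMaybe (columns X))) (spans x (Equivalence.to T-≡ x∈X)))
      where
      row≡ : All (λ y → adj G x y ≡ cutRow X x y) (columns X)
      row≡ = All.map (λ y∉X → sym (cutRow-outside X x y∉X)) (all-filter _ (allFin n))

    rows∈ : All (λ r → entry r ∈⟨ map (pull (lookupMaybe (columns X))) vs ⟩) (cutMatrix G X)
    rows∈ = map⁺ (All.map (λ {x} → row∈ {x}) (all-filter _ (allFin n)))

  positionOutside : Subset n → Fin n → Maybe ℕ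
  positionOutside X y = if inS X y then nothing else just (position Fin._≟_ (columns X) y)

  spanning-set-≤-ρ : ∀ X → ∃[ vs ] length vs ≤ ρ G X × CutSpannedBy X vs
  spanning-set-≤-ρ X with ws , len , rows∈ ← spanning-≤-rankAux n (columns-length X) (cutMatrix-width X) =
    map (pull (positionOutside X)) ws , ≤-trans (≤-reflexive (length-map _ ws)) len , spans
    where
    pull-row : ∀ x → pull (positionOutside X) (entry (map (adj G x) (columns X))) ≗ cutRow X x
    pull-row x y with inS X y in X[y]
    ... | true  = refl
    ... | false = entry-map-position Fin._≟_ (adj G x) y∈columns
      where
      y∈columns : y ∈ columns X
      y∈columns = ∈-filter⁺ _ (∈-allFin y) (Equivalence.from T-≡ (cong not X[y]))

    spans : CutSpannedBy X (map (pull (positionOutside X)) ws)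
    spans x x∈X =
      ∈⟨⟩-resp-≗ (pull-row x) (∈⟨⟩-map (pull-isLinear (positionOutside X)) (All.lookup (map⁻ rows∈) x∈rows))
      where
      x∈rows : x ∈ filter (λ x → T? (inS X x)) (allFin n)
      x∈rows = ∈-filter⁺ _ (∈-allFin x) (Equivalence.from T-≡ x∈X)

  cutRow-⊕ : ∀ X A B x → (∀ y → inS X y ≡ false → inS A y xor inS B y ≡ true) →
             cutRow X x ≗ mask (outside X) (cutRow A x) ⊕ mask (outside X) (cutRow B x)
  cutRow-⊕ X A B x split y with inS X y in y∉X
  ... | true  = refl
  ... | false = complementary (inS A y) (inS B y) (adj G x y) (split y y∉X)
    where
    complementary : ∀ a b c → a xor b ≡ true → c ≡ (not a ∧ c) xor (not b ∧ c)
    complementary true  false c _ = refl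
    complementary false true  c _ = sym (xor-identityʳ c)

  cutRow-∈⟨⟩ : ∀ X A B {vs ws} x → CutSpannedBy A vs → CutSpannedBy B ws →
               (∀ y → inS X y ≡ false → inS A y xor inS B y ≡ true) → inS A x ≡ true → inS B x ≡ true →
               cutRow X x ∈⟨ map (mask (outside X)) vs ++ map (mask (outside X)) ws ⟩
  cutRow-∈⟨⟩ X A B {vs} x A-spans B-spans split x∈A x∈B =
    ∈⟨⟩-resp-≗ (λ y → sym (cutRow-⊕ X A B x split y))
      (∈⟨⟩-⊕ (∈⟨⟩-++⁺ˡ _ (∈⟨⟩-map (mask-isLinear (outside X)) (A-spans x x∈A)))
             (∈⟨⟩-++⁺ʳ (map (mask (outside X)) vs) (∈⟨⟩-map (mask-isLinear (outside X)) (B-spans x x∈B))))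

  ρ-≤-translates : ∀ X S → ρ G X ≤ (ρ G S + ρ G (S Δ ∁ X)) + (ρ G (S Δ ⊤) + ρ G (S Δ X))
  ρ-≤-translates X S
    with vs₁ , l₁ , s₁ ← spanning-set-≤-ρ S       | vs₂ , l₂ , s₂ ← spanning-set-≤-ρ (S Δ ∁ X)
       | vs₃ , l₃ , s₃ ← spanning-set-≤-ρ (S Δ ⊤) | vs₄ , l₄ , s₄ ← spanning-set-≤-ρ (S Δ X) = begin
    ρ G X                                                 ≤⟨ ρ-≤-spanning-set X spans ⟩
    length (masked vs₁ vs₂ ++ masked vs₃ vs₄)             ≡⟨ length-++ (masked vs₁ vs₂) ⟩
    length (masked vs₁ vs₂) + length (masked vs₃ vs₄)     ≡⟨ cong₂ _+_ (length-masked vs₁ vs₂) (length-masked vs₃ vs₄) ⟩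
    (length vs₁ + length vs₂) + (length vs₃ + length vs₄) ≤⟨ +-mono-≤ (+-mono-≤ l₁ l₂) (+-mono-≤ l₃ l₄) ⟩
    (ρ G S + ρ G (S Δ ∁ X)) + (ρ G (S Δ ⊤) + ρ G (S Δ X)) ∎
    where
    open ≤-Reasoning

    masked : List (Fin n → Bool) → List (Fin n → Bool) → List (Fin n → Bool)
    masked vs ws = map (mask (outside X)) vs ++ map (mask (outside X)) ws

    length-masked : ∀ vs ws → length (masked vs ws) ≡ length vs + length ws
    length-masked vs ws = trans (length-++ (map _ vs)) (cong₂ _+_ (length-map _ vs) (length-map _ ws))

    split₁ : ∀ y → inS X y ≡ false → inS S y xor inS (S Δ ∁ X) y ≡ true
    split₁ y y∉X = trans (cong (inS S y xor_) (inS-Δ S (∁ X) (inS-∁ X y∉X))) (xor-cancelˡ (inS S y) true)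

    split₂ : ∀ y → inS X y ≡ false → inS (S Δ ⊤) y xor inS (S Δ X) y ≡ true
    split₂ y y∉X = trans (cong₂ _xor_ (inS-Δ S ⊤ (inS-⊤ y)) (inS-Δ S X y∉X)) (xor-cancel-common (inS S y) true false)

    spans : CutSpannedBy X (masked vs₁ vs₂ ++ masked vs₃ vs₄)
    spans x x∈X with inS S x in x∈S
    ... | true  = ∈⟨⟩-++⁺ˡ _ (cutRow-∈⟨⟩ X S (S Δ ∁ X) x s₁ s₂ split₁ x∈S x∈S∆∁X)
      where
      x∈S∆∁X : inS (S Δ ∁ X) x ≡ true
      x∈S∆∁X = trans (inS-Δ S (∁ X) (inS-∁ X x∈X)) (cong (_xor false) x∈S)
    ... | false = ∈⟨⟩-++⁺ʳ (masked vs₁ vs₂)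
                    (cutRow-∈⟨⟩ X (S Δ ⊤) (S Δ X) x s₃ s₄ split₂ x∈S∆⊤ x∈S∆X)
      where
      x∈S∆⊤ : inS (S Δ ⊤) x ≡ true
      x∈S∆⊤ = trans (inS-Δ S ⊤ (inS-⊤ x)) (cong (_xor true) x∈S)
      x∈S∆X : inS (S Δ X) x ≡ true
      x∈S∆X = trans (inS-Δ S X x∈X) (cong (_xor true) x∈S)

-- Averaging over all subsets

length-allSubsets : ∀ n → length (allSubsets n) ≡ 2 ^ n
length-allSubsets zero    = refl
length-allSubsets (suc n) = begin
  length (map (true Vec.∷_) A ++ map (false Vec.∷_) A)      ≡⟨ length-++ (map (true Vec.∷_) A) ⟩
  length (map (true Vec.∷_) A) + length (map (false Vec.∷_) A) ≡⟨ cong₂ _+_ (length-map _ A) (length-map _ A) ⟩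
  length A + length A                                         ≡⟨ cong (λ k → k + k) (length-allSubsets n) ⟩
  2 ^ n + 2 ^ n                                               ≡⟨ cong (2 ^ n +_) (+-identityʳ (2 ^ n)) ⟨
  2 ^ suc n                                                   ∎
  where
  open ≡-Reasoning
  A = allSubsets n

sum-allSubsets-suc : ∀ {n} (g : Subset (suc n) → ℕ) →
                     sum (map g (allSubsets (suc n))) ≡
                     sum (map (g ∘ (true Vec.∷_)) (allSubsets n)) + sum (map (g ∘ (false Vec.∷_)) (allSubsets n))
sum-allSubsets-suc {n} g = begin
  sum (map g (map (true Vec.∷_) A ++ map (false Vec.∷_) A))           ≡⟨ cong sum (map-++ g (map _ A) (map _ A)) ⟩
  sum (map g (map (true Vec.∷_) A) ++ map g (map (false Vec.∷_) A))   ≡⟨ sum-++ (map g (map _ A)) _ ⟩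
  sum (map g (map (true Vec.∷_) A)) + sum (map g (map (false Vec.∷_) A))
    ≡⟨ cong₂ _+_ (cong sum (map-∘ A)) (cong sum (map-∘ A)) ⟨
  sum (map (g ∘ (true Vec.∷_)) A) + sum (map (g ∘ (false Vec.∷_)) A) ∎
  where
  open ≡-Reasoning
  A = allSubsets n

sum-allSubsets-Δ : ∀ {n} (g : Subset n → ℕ) C →
                   sum (map (λ S → g (S Δ C)) (allSubsets n)) ≡ sum (map g (allSubsets n))
sum-allSubsets-Δ {zero}  g Vec.[]        = refl
sum-allSubsets-Δ {suc n} g (b Vec.∷ C) = begin
  sum (map (λ S → g (S Δ (b Vec.∷ C))) (allSubsets (suc n))) ≡⟨ sum-allSubsets-suc (λ S → g (S Δ (b Vec.∷ C))) ⟩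
  translated (true xor b) + translated b                      ≡⟨ halves b ⟩
  part true + part false                                      ≡⟨ sum-allSubsets-suc g ⟨
  sum (map g (allSubsets (suc n)))                            ∎
  where
  open ≡-Reasoning
  part translated : Bool → ℕ
  part c       = sum (map (g ∘ (c Vec.∷_)) (allSubsets n))
  translated c = sum (map (λ S → g (c Vec.∷ S Δ C)) (allSubsets n))

  translated≡part : ∀ c → translated c ≡ part c
  translated≡part c = sum-allSubsets-Δ (g ∘ (c Vec.∷_)) C

  halves : ∀ b → translated (true xor b) + translated b ≡ part true + part false
  halves false = cong₂ _+_ (translated≡part true) (translated≡part false)
  halves true  = trans (cong₂ _+_ (translated≡part false) (translated≡part true)) (+-comm (part false) (part true))

sum-map-+ : ∀ {A : Set} (f g : A → ℕ) xs → sum (map (λ x → f x + g x) xs) ≡ sum (map f xs) + sum (map g xs)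
sum-map-+ f g []       = refl
sum-map-+ f g (x ∷ xs) = trans (cong (f x + g x +_) (sum-map-+ f g xs)) (+-interchange (f x) (g x) _ _)

length-*-≤-sum : ∀ {A : Set} {k} {f : A → ℕ} xs → (∀ x → k ≤ f x) → length xs * k ≤ sum (map f xs)
length-*-≤-sum []       _   = z≤n
length-*-≤-sum (x ∷ xs) k≤f = +-mono-≤ (k≤f x) (length-*-≤-sum xs k≤f)

*-foldr-⊔-≤ : ∀ {A : Set} k {b} (f : A → ℕ) → (∀ x → k * f x ≤ b) → ∀ xs → k * foldr _⊔_ 0 (map f xs) ≤ b
*-foldr-⊔-≤ k f k*f≤b []       = ≤-trans (≤-reflexive (*-zeroʳ k)) z≤n
*-foldr-⊔-≤ k f k*f≤b (x ∷ xs) =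
  ≤-trans (≤-reflexive (*-distribˡ-⊔ k (f x) _)) (⊔-lub (k*f≤b x) (*-foldr-⊔-≤ k f k*f≤b xs))

2^n*ρ≤4*sumρ : ∀ {n} (G : Graph n) X → 2 ^ n * ρ G X ≤ 4 * sumρ G
2^n*ρ≤4*sumρ {n} G X = begin
  2 ^ n * ρ G X               ≡⟨ cong (_* ρ G X) (length-allSubsets n) ⟨
  length A * ρ G X            ≤⟨ length-*-≤-sum A (ρ-≤-translates G X) ⟩
  sum (map translates A)      ≡⟨ trans (sum-map-+ _ _ A) (cong₂ _+_ (sum-map-+ _ _ A) (sum-map-+ _ _ A)) ⟩
  (s + Σ (∁ X)) + (Σ ⊤ + Σ X) ≡⟨ cong₂ _+_ (cong (s +_) (sum-allSubsets-Δ (ρ G) (∁ X)))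
                                            (cong₂ _+_ (sum-allSubsets-Δ (ρ G) ⊤) (sum-allSubsets-Δ (ρ G) X)) ⟩
  (s + s) + (s + s)           ≡⟨ +-assoc s s (s + s) ⟩
  s + (s + (s + s))           ≡⟨ cong (λ t → s + (s + (s + t))) (+-identityʳ s) ⟨
  4 * sumρ G                  ∎
  where
  open ≤-Reasoning
  A = allSubsets n
  s = sumρ G
  Σ : Subset n → ℕ
  Σ C = sum (map (λ S → ρ G (S Δ C)) A)
  translates : Subset n → ℕ
  translates S = (ρ G S + ρ G (S Δ ∁ X)) + (ρ G (S Δ ⊤) + ρ G (S Δ X))

lemma5p2 : (n : ℕ) (G : Graph n) → 2 ^ n * maxρ G ≤ 4 * sumρ G
lemma5p2 n G = *-foldr-⊔-≤ (2 ^ n) (ρ G) (2^n*ρ≤4*sumρ G) (allSubsets n)
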